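{- Let $[\ell,u]$ be a thin degree sequence interval, let $X,Y\in\mathcal{G}(\ell,u)$ and let $s\in S_{X,Y}$. Let $\nabla_{X,Y}=W^s_1\uplus\cdots\uplus W^s_{p_s}$ be the partition of $\nabla_{X,Y}$ into the vertex sets of the connected components of $L(\nabla_{X,Y},s)$. Then for every $1\le k\le p_s$, the restriction $s|_{W^s_k}$ is $(X,Y)$-alternating and describes an Eulerian trail on the edge set $W^s_k$. If $s|_{W^s_k}$ describes an open trail, then its two end-vertices are distinct, and they are disjoint from the end-vertices of any other open trail $s|_{W^s_j}$ with $j\neq k$.
   Context: Graphs are simple on vertex set $[n]$. A degree sequence is $d\in\mathbb{N}^n$ with coordinates at most $n-1$; for degree sequences $\ell\le u$ coordinatewise, $\mathcal{G}(\ell,u)$ is the set of graphs on $[n]$ whose degree sequence $d$ satisfies $\ell\le d\le u$; $[\ell,u]$ is thin if $u_i\le\ell_i+1$ for all $i$. For $\nabla\subseteq\binom{[n]}{2}$ and $v\in[n]$ let $\nabla_v=\{e\in\nabla: v\in e\}$. A pairing function on $\nabla$ is a map $s:\{(v,e): v\in e\in\nabla\}\to\nabla$ such that for each $v$, $e\mapsto s(v,e)$ is an involution of $\nabla_v$; $\Pi(\nabla)$ is the set of these. $L(\nabla,s)$ is the graph on vertex set $\nabla$ in which distinct $e,f$ are adjacent iff $s(v,e)=f$ for some $v\in e\cap f$. For $W\subseteq\nabla$, $s|_W$ is the restriction of $s$ to pairs $(v,e)$ with $e\in W$ and $s(v,e)\in W$. A connected component of $L(\nabla,s)$ that is a cycle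 corresponds to a closed trail, and one that is a path to an open trail traversing its edges in the order given by $s$ (the end-vertices of an open trail being the vertices $v$ with $s(v,e)=e$ at its end edges). For a graph $Z$, $s\in\Pi(\nabla)$ is $Z$-alternating if for every $v\in e\in\nabla$ either $e$ is the unique fixpoint of $s(v,\cdot)$ (so $s(v,\cdot)$ has at most one fixpoint), or $e\in E(Z)$ and $s(v,e)\notin E(Z)$, or $e\notin E(Z)$ and $s(v,e)\in E(Z)$. Let $\nabla_{X,Y}=E(X)\triangle E(Y)$; $s\in\Pi(\nabla_{X,Y})$ is $(X,Y)$-alternating if it is both $X$-alternating and $Y$-alternating; $S_{X,Y}$ is the set of $(X,Y)$-alternating $s\in\Pi(\nabla_{X,Y})$. For a general $W$ (a subset of $\nabla_{X,Y}$), $s|_W$ being $(X,Y)$-alternating means the same condition applied to $s|_W$ as a pairing function on $W$. -}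

module Defs where

open import Data.Nat using (ℕ; zero; suc; _+_; _∸_; _≤_)
open import Data.Fin as Fin using (Fin; inject₁; fromℕ)
open import Data.Fin.Properties using (<-cmp)
open import Data.Bool using (Bool; true; false; if_then_else_; _xor_; T)
open import Data.List using (List; map; allFin)
open import Data.Nat.ListAction using (sum)
open import Data.Product using (Σ; ∃; _×_; _,_; proj₁; proj₂)
open import Data.Sum using (_⊎_)
open import Relation.Nullary using (¬_)
open import Relation.Binary using (tri<; tri≈; tri>)
open import Relation.Binary.PropositionalEquality using (_≡_; _≢_)
open import Relation.Binary.Construct.Closure.ReflexiveTransitive using (Star)
open import Function.Definitions using (Injective)

-- Vertices are Fin n (= [n]).  An element of binom([n],2) is an ordered
-- pair (i , j) with i < j, i.e. a 2-subset written in increasing order.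

Edge : ℕ → Set
Edge n = Σ (Fin n × Fin n) (λ p → proj₁ p Fin.< proj₂ p)

_∈ₑ_ : ∀ {n} → Fin n → Edge n → Set
v ∈ₑ ((i , j) , _) = (v ≡ i) ⊎ (v ≡ j)

Joins : ∀ {n} → Edge n → Fin n → Fin n → Set
Joins (p , _) a b = (p ≡ (a , b)) ⊎ (p ≡ (b , a))

Graph : ℕ → Set
Graph n = Edge n → Bool

adj : ∀ {n} → Graph n → Fin n → Fin n → Bool
adj X v w with <-cmp v w
... | tri< v<w _ _ = X ((v , w) , v<w)
... | tri≈ _ _ _   = false
... | tri> _ _ w<v = X ((w , v) , w<v)

deg : ∀ {n} → Graph n → Fin n → ℕ
deg {n} X v = sum (map (λ w → if adj X v w then 1 else 0) (allFin n))

IsDegSeq : ∀ {n} → (Fin n → ℕ) → Set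
IsDegSeq {n} d = ∀ i → d i ≤ n ∸ 1

Thin : ∀ {n} → (Fin n → ℕ) → (Fin n → ℕ) → Set
Thin ℓ u = ∀ i → u i ≤ ℓ i + 1

InG : ∀ {n} → (Fin n → ℕ) → (Fin n → ℕ) → Graph n → Set
InG ℓ u X = ∀ v → (ℓ v ≤ deg X v) × (deg X v ≤ u v)

EdgeSet : ℕ → Set₁
EdgeSet n = Edge n → Set

Δ : ∀ {n} → Graph n → Graph n → EdgeSet n
Δ X Y e = T (X e xor Y e)

-- A candidate pairing function is a total map (v , e) ↦ s(v , e); only its
-- values on {(v , e) : v ∈ e ∈ ∇} matter.
PairFun : ℕ → Set
PairFun n = Fin n → Edge n → Edge n

IsPairing : ∀ {n} → EdgeSet n → PairFun n → Set
IsPairing ∇ s = ∀ v e → v ∈ₑ e → ∇ e →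
  ∇ (s v e) × v ∈ₑ s v e × s v (s v e) ≡ e

-- The restriction s|_W is s on the pairs (v , e) with e ∈ W
-- and s(v , e) ∈ W; it is a pairing function on W exactly when every pair
-- v ∈ e ∈ W lies in that domain and s(v , ·) is an involution of W_v.
RestrictionIsPairing : ∀ {n} → EdgeSet n → PairFun n → Set
RestrictionIsPairing W s = IsPairing W s

IsUniqueFix : ∀ {n} → EdgeSet n → PairFun n → Fin n → Edge n → Set
IsUniqueFix ∇ s v e = (s v e ≡ e) × (∀ f → v ∈ₑ f → ∇ f → s v f ≡ f → f ≡ e)

Alternating : ∀ {n} → Graph n → EdgeSet n → PairFun n → Set
Alternating Z ∇ s = ∀ v e → v ∈ₑ e → ∇ e →
    IsUniqueFix ∇ s v e
  ⊎ (T (Z e) × (Z (s v e) ≡ false))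
  ⊎ ((Z e ≡ false) × T (Z (s v e)))

InS : ∀ {n} → Graph n → Graph n → PairFun n → Set
InS X Y s = IsPairing (Δ X Y) s × Alternating X (Δ X Y) s × Alternating Y (Δ X Y) s

Linked : ∀ {n} → PairFun n → Edge n → Edge n → Set
Linked s e f = ∃ λ v → v ∈ₑ e × v ∈ₑ f × s v e ≡ f

-- adjacency in L(∇ , s) (taken symmetric, as L is an undirected graph)
LAdj : ∀ {n} → EdgeSet n → PairFun n → Edge n → Edge n → Set
LAdj ∇ s e f = ∇ e × ∇ f × e ≢ f × (Linked s e f ⊎ Linked s f e)

Comp : ∀ {n} → EdgeSet n → PairFun n → Edge n → EdgeSet n
Comp ∇ s e₀ f = Star (LAdj ∇ s) e₀ f

-- A trail traversing the edges e₀ , … , e_m in the order given by s,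
-- through vertices v₀ , … , v_{m+1}  (e_i = {v_i , v_{i+1}}).

record TrailData (n : ℕ) : Set where
  field
    m  : ℕ
    es : Fin (suc m) → Edge n
    vs : Fin (suc (suc m)) → Fin n

open TrailData public

IsTrailOf : ∀ {n} → EdgeSet n → PairFun n → TrailData n → Set
IsTrailOf W s D =
    Injective _≡_ _≡_ (es D)
  × (∀ i → W (es D i))
  × (∀ f → W f → ∃ λ i → es D i ≡ f)
  × (∀ i → Joins (es D i) (vs D (inject₁ i)) (vs D (Fin.suc i)))
  × (∀ (i : Fin (m D)) →
       s (vs D (Fin.suc (inject₁ i))) (es D (inject₁ i)) ≡ es D (Fin.suc i))

ClosedTrail : ∀ {n} → PairFun n → TrailData n → Set
ClosedTrail s D =
  (vs D (fromℕ (suc (m D))) ≡ vs D Fin.zero)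
  × (s (vs D Fin.zero) (es D (fromℕ (m D))) ≡ es D Fin.zero)

OpenTrail : ∀ {n} → PairFun n → TrailData n → Set
OpenTrail s D =
  (s (vs D Fin.zero) (es D Fin.zero) ≡ es D Fin.zero)
  × (s (vs D (fromℕ (suc (m D)))) (es D (fromℕ (m D))) ≡ es D (fromℕ (m D)))

startV endV : ∀ {n} → TrailData n → Fin n
startV D = vs D Fin.zero
endV   D = vs D (fromℕ (suc (m D)))

DescribesEulerianTrail : ∀ {n} → EdgeSet n → PairFun n → Set
DescribesEulerianTrail W s =
  ∃ λ (D : TrailData _) → IsTrailOf W s D × (ClosedTrail s D ⊎ OpenTrail s D)

DisjointEnds : ∀ {n} → Fin n → Fin n → Fin n → Fin n → Set
DisjointEnds a b c d = (a ≢ c) × (a ≢ d) × (b ≢ c) × (b ≢ d)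

{-# OPTIONS --safe #-}
-- Each s(v , ·) pairs up the edges of ∇ at v, so following s edge by edge from any edge
-- of ∇ is a walk that, being driven by involutions, can never revisit an edge except by
-- closing up at its start; by finiteness it either closes up or reaches an edge fixed by
-- s at its current vertex, in which case walking back from that edge traces an open trail.
-- Either way the edges visited are closed under s, so they form the whole component of
-- L(∇ , s). The end-vertices of an open trail carry edges fixed by s, and (X , Y)-alternation
-- allows at most one such edge per vertex: two open trails sharing an end-vertex would share
-- that edge and so lie in one component, and for the same reason the two ends of one open
-- trail differ.

module Submission where

open import Defs
open import Data.Nat using (ℕ; zero; suc; _*_; _+_; _≤_; _<_; z≤n; s≤s)
open import Data.Nat.Properties
  using ( ≤-refl; ≤-reflexive; ≤-pred; ≤-antisym; <⇒≤; <⇒≱; ≮⇒≥; <-cmp; n<1+n; m≤n⇒m<n∨m≡n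
        ; +-suc; +-identityʳ)
open import Data.Fin as Fin using (Fin; toℕ; fromℕ; fromℕ<; combine)
import Data.Fin.Properties as Finₚ
open import Data.Product using (∃; _×_; _,_; proj₁; proj₂)
open import Data.Sum using (_⊎_; inj₁; inj₂)
import Data.Sum as Sum
open import Data.Bool using (T)
open import Data.Empty using (⊥-elim)
open import Function using (_∘_)
open import Relation.Nullary using (¬_; Dec; yes; no)
open import Relation.Nullary.Decidable using (map′)
open import Relation.Unary using (_⊆_)
open import Relation.Binary using (tri<; tri≈; tri>)
open import Relation.Binary.PropositionalEquality
  using (_≡_; _≢_; refl; sym; trans; cong; cong₂; subst)
open import Relation.Binary.Construct.Closure.ReflexiveTransitive
  using (Star; ε; _◅_; _◅◅_; reverse)

private
  variable
    n : ℕ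

other : Edge n → Fin n → Fin n
other ((i , j) , _) v with v Fin.≟ i
... | yes _ = j
... | no _  = i

joins-other : ∀ (e : Edge n) {v} → v ∈ₑ e → Joins e v (other e v)
joins-other ((i , j) , _) {.i} (inj₁ refl) with i Fin.≟ i
... | yes _  = inj₁ refl
... | no i≢i = ⊥-elim (i≢i refl)
joins-other ((i , j) , i<j) {.j} (inj₂ refl) with j Fin.≟ i
... | yes j≡i = ⊥-elim (Finₚ.<-irrefl (sym j≡i) i<j)
... | no _    = inj₂ refl

joins-∈₁ : ∀ (e : Edge n) {a b} → Joins e a b → a ∈ₑ e
joins-∈₁ e (inj₁ eq) = inj₁ (cong proj₁ (sym eq))
joins-∈₁ e (inj₂ eq) = inj₂ (cong proj₂ (sym eq))

joins-∈₂ : ∀ (e : Edge n) {a b} → Joins e a b → b ∈ₑ e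
joins-∈₂ e (inj₁ eq) = inj₂ (cong proj₂ (sym eq))
joins-∈₂ e (inj₂ eq) = inj₁ (cong proj₁ (sym eq))

joins-≢ : ∀ (e : Edge n) {a b} → Joins e a b → a ≢ b
joins-≢ ((i , j) , i<j) (inj₁ eq) refl =
  Finₚ.<-irrefl (trans (cong proj₁ eq) (sym (cong proj₂ eq))) i<j
joins-≢ ((i , j) , i<j) (inj₂ eq) refl =
  Finₚ.<-irrefl (trans (cong proj₁ eq) (sym (cong proj₂ eq))) i<j

joins-cases : ∀ (e : Edge n) {a b c} → Joins e a b → c ∈ₑ e → c ≡ a ⊎ c ≡ b
joins-cases e (inj₁ eq) (inj₁ c≡i) = inj₁ (trans c≡i (cong proj₁ eq))
joins-cases e (inj₁ eq) (inj₂ c≡j) = inj₂ (trans c≡j (cong proj₂ eq))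
joins-cases e (inj₂ eq) (inj₁ c≡i) = inj₂ (trans c≡i (cong proj₁ eq))
joins-cases e (inj₂ eq) (inj₂ c≡j) = inj₁ (trans c≡j (cong proj₂ eq))

encode : Edge n → Fin (n * n)
encode ((i , j) , _) = combine i j

encode-injective : ∀ (e f : Edge n) → encode e ≡ encode f → e ≡ f
encode-injective ((i , j) , i<j) ((k , l) , k<l) eq
  with Finₚ.combine-injective i j k l eq
... | refl , refl = cong ((i , j) ,_) (Finₚ.<-irrelevant i<j k<l)

_≟ₑ_ : (e f : Edge n) → Dec (e ≡ f)
e ≟ₑ f = map′ (encode-injective e f) (cong encode) (encode e Fin.≟ encode f)

module _ {∇ : EdgeSet n} {s : PairFun n} where

  pairing-flip : IsPairing ∇ s → ∀ {v e f} → v ∈ₑ e → ∇ e → s v e ≡ f → s v f ≡ e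
  pairing-flip pairing {v} {e} v∈e ∇e refl = proj₂ (proj₂ (pairing v e v∈e ∇e))

  LAdj-sym : ∀ {e f} → LAdj ∇ s e f → LAdj ∇ s f e
  LAdj-sym (∇e , ∇f , e≢f , linked) = ∇f , ∇e , e≢f ∘ sym , Sum.swap linked

  Comp-⊆ : ∀ {e₀} → ∇ e₀ → Comp ∇ s e₀ ⊆ ∇
  Comp-⊆ ∇e₀ ε               = ∇e₀
  Comp-⊆ ∇e₀ (e~f ◅ f~g) = Comp-⊆ (proj₁ (proj₂ e~f)) f~g

  LAdj⇒paired : IsPairing ∇ s → ∀ {e f} → LAdj ∇ s e f → ∃ λ v → v ∈ₑ e × s v e ≡ f
  LAdj⇒paired _       (_ , _ , _ , inj₁ (v , v∈e , _ , sve≡f)) = v , v∈e , sve≡f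
  LAdj⇒paired pairing (_ , ∇f , _ , inj₂ (v , v∈f , v∈e , svf≡e)) =
    v , v∈e , pairing-flip pairing v∈f ∇f svf≡e

  s-closed⇒Star-closed : IsPairing ∇ s → (P : EdgeSet n) → (∀ {v e} → v ∈ₑ e → P e → P (s v e))
                       → ∀ {e f} → Star (LAdj ∇ s) e f → P e → P f
  s-closed⇒Star-closed pairing P closed ε           Pe = Pe
  s-closed⇒Star-closed pairing P closed (e~f ◅ f~g) Pe
    with LAdj⇒paired pairing e~f
  ... | v , v∈e , refl = s-closed⇒Star-closed pairing P closed f~g (closed v∈e Pe)

  Comp-isPairing : IsPairing ∇ s → ∀ {e₀} → ∇ e₀ → IsPairing (Comp ∇ s e₀) s
  Comp-isPairing pairing {e₀} ∇e₀ v e v∈e e₀~e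
    with pairing v e v∈e (Comp-⊆ ∇e₀ e₀~e)
  ... | ∇sve , v∈sve , involutive = e₀~sve , v∈sve , involutive
    where
      e₀~sve : Comp ∇ s e₀ (s v e)
      e₀~sve with s v e ≟ₑ e
      ... | yes sve≡e = subst (Comp ∇ s e₀) (sym sve≡e) e₀~e
      ... | no sve≢e  = e₀~e ◅◅ (e~sve ◅ ε)
        where
          e~sve : LAdj ∇ s e (s v e)
          e~sve = Comp-⊆ ∇e₀ e₀~e , ∇sve , sve≢e ∘ sym , inj₁ (v , v∈e , v∈sve , refl)

Alternating-⊆ : ∀ {Z : Graph n} {W ∇ : EdgeSet n} {s}
              → W ⊆ ∇ → Alternating Z ∇ s → Alternating Z W s
Alternating-⊆ W⊆∇ alt v e v∈e We with alt v e v∈e (W⊆∇ We)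
... | inj₁ (fixed , unique) = inj₁ (fixed , λ f v∈f Wf → unique f v∈f (W⊆∇ Wf))
... | inj₂ alternates       = inj₂ alternates

FixedAt : EdgeSet n → PairFun n → Fin n → Edge n → Set
FixedAt W s v g = v ∈ₑ g × W g × s v g ≡ g

AtMostOneFixed : EdgeSet n → PairFun n → Set
AtMostOneFixed W s = ∀ {v g h} → FixedAt W s v g → FixedAt W s v h → g ≡ h

-- A fixed edge e has Z e ≡ Z (s v e), so only the unique-fixpoint clause can apply.
Alternating⇒atMostOneFixed : ∀ {Z : Graph n} {W s} → Alternating Z W s → AtMostOneFixed W s
Alternating⇒atMostOneFixed {Z = Z} alt {v} {g} {h} (v∈g , Wg , sg≡g) (v∈h , Wh , sh≡h)
  with alt v g v∈g Wg
... | inj₁ (_ , unique)           = sym (unique h v∈h Wh sh≡h)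
... | inj₂ (inj₁ (Zg , Zsg≡false)) = ⊥-elim (subst T (trans (cong Z (sym sg≡g)) Zsg≡false) Zg)
... | inj₂ (inj₂ (Zg≡false , Zsg)) = ⊥-elim (subst T (trans (cong Z sg≡g) Zg≡false) Zsg)

module Walk {∇ : EdgeSet n} {s : PairFun n} (pairing : IsPairing ∇ s)
            (g : Edge n) (a : Fin n) (∇g : ∇ g) (a∈g : a ∈ₑ g) where

  -- dart k = (E k , V (suc k)): the k-th edge with the vertex through which the walk leaves it.
  dart : ℕ → Edge n × Fin n
  dart zero    = g , other g a
  dart (suc k) = let (e , v) = dart k in s v e , other (s v e) v

  E : ℕ → Edge n
  E = proj₁ ∘ dart

  V : ℕ → Fin n
  V zero    = a
  V (suc k) = proj₂ (dart k)

  ∇E    : ∀ k → ∇ (E k)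
  joins : ∀ k → Joins (E k) (V k) (V (suc k))

  ∇E zero    = ∇g
  ∇E (suc k) = proj₁ (pairing (V (suc k)) (E k) (joins-∈₂ (E k) (joins k)) (∇E k))

  joins zero    = joins-other g a∈g
  joins (suc k) = joins-other (E (suc k))
    (proj₁ (proj₂ (pairing (V (suc k)) (E k) (joins-∈₂ (E k) (joins k)) (∇E k))))

  s-back : ∀ k → s (V (suc k)) (E (suc k)) ≡ E k
  s-back k = pairing-flip pairing (joins-∈₂ (E k) (joins k)) (∇E k) refl

  Distinct : ℕ → Set
  Distinct k = ∀ i j → i < j → j ≤ k → E i ≢ E j

  Closes : ℕ → Set
  Closes k = E (suc k) ≡ E 0 × V (suc k) ≡ V 0

  -- If E (suc k) repeats E i, then s (V (suc k)) maps E i back to E k. Unless i = 0 and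
  -- V (suc k) = V 0, the walk itself already shows s at that endpoint of E i mapping E i to
  -- a neighbouring walk edge, which distinctness forbids from being E k.
  private
    exit-on-repeat : ∀ k i → E i ≡ E (suc k) → V (suc k) ∈ₑ E i
    exit-on-repeat k i Ei≡ = subst (V (suc k) ∈ₑ_) (sym Ei≡) (joins-∈₁ (E (suc k)) (joins (suc k)))

    s-at-repeat : ∀ k i → E i ≡ E (suc k) → s (V (suc k)) (E i) ≡ E k
    s-at-repeat k i Ei≡ = trans (cong (s (V (suc k))) Ei≡) (s-back k)

    repeat-not-exited : ∀ {k i} → Distinct k → E (suc k) ≢ E k → i ≤ k
                      → E i ≡ E (suc k) → V (suc k) ≢ V (suc i)
    repeat-not-exited {k} {i} distinct moved i≤k Ei≡ x≡
      with trans (cong (λ x → s x (E i)) (sym x≡)) (s-at-repeat k i Ei≡) | <-cmp (suc i) k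
    ... | E[1+i]≡Ek | tri< 1+i<k _ _ = distinct (suc i) k 1+i<k ≤-refl E[1+i]≡Ek
    ... | _         | tri≈ _ refl _  = joins-≢ (E k) (joins k) (sym x≡)
    ... | _         | tri> _ _ k<1+i with ≤-antisym i≤k (≤-pred k<1+i)
    ...   | refl = moved (sym Ei≡)

    repeat-not-entered : ∀ {k i} → Distinct k → suc i ≤ k
                       → E (suc i) ≡ E (suc k) → V (suc k) ≢ V (suc i)
    repeat-not-entered {k} {i} distinct i<k Ei≡ x≡ =
      distinct i k i<k ≤-refl
        (trans (sym (s-back i)) (trans (cong (λ x → s x (E (suc i))) (sym x≡)) (s-at-repeat k (suc i) Ei≡)))

  returns-to-start : ∀ {k i} → Distinct k → E (suc k) ≢ E k → i ≤ k → E i ≡ E (suc k)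
                   → i ≡ 0 × V (suc k) ≡ V 0
  returns-to-start {k} {zero} distinct moved i≤k Ei≡ with joins-cases (E 0) (joins 0) (exit-on-repeat k 0 Ei≡)
  ... | inj₁ x≡V₀ = refl , x≡V₀
  ... | inj₂ x≡V₁ = ⊥-elim (repeat-not-exited distinct moved i≤k Ei≡ x≡V₁)
  returns-to-start {k} {suc i} distinct moved i≤k Ei≡
    with joins-cases (E (suc i)) (joins (suc i)) (exit-on-repeat k (suc i) Ei≡)
  ... | inj₁ x≡V = ⊥-elim (repeat-not-entered distinct i≤k Ei≡ x≡V)
  ... | inj₂ x≡V = ⊥-elim (repeat-not-exited distinct moved i≤k Ei≡ x≡V)

  distinct-step : ∀ {k} → Distinct k → E (suc k) ≢ E k → Distinct (suc k) ⊎ Closes k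
  distinct-step {k} distinct moved with E 0 ≟ₑ E (suc k)
  ... | yes E₀≡ = inj₂ (sym E₀≡ , proj₂ (returns-to-start distinct moved z≤n E₀≡))
  ... | no E₀≢  = inj₁ distinct′
    where
      distinct′ : Distinct (suc k)
      distinct′ i j i<j j≤1+k Ei≡Ej with m≤n⇒m<n∨m≡n j≤1+k
      ... | inj₁ j≤k = distinct i j i<j (≤-pred j≤k) Ei≡Ej
      ... | inj₂ refl with returns-to-start distinct moved (≤-pred i<j) Ei≡Ej
      ...   | refl , _ = E₀≢ Ei≡Ej

  distinct-bounded : ∀ {k} → Distinct k → suc k ≤ n * n
  distinct-bounded {k} distinct = ≮⇒≥ λ n²<1+k →
    let i , j , i<j , eq = Finₚ.pigeonhole n²<1+k (encode ∘ E ∘ toℕ)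
    in distinct (toℕ i) (toℕ j) i<j (≤-pred (Finₚ.toℕ<n j)) (encode-injective _ _ eq)

  data Outcome : Set where
    halts  : ∀ k → Distinct k → s (V (suc k)) (E k) ≡ E k → Outcome
    closes : ∀ k → Distinct k → E (suc k) ≢ E k → Closes k → Outcome

  private
    search : ∀ fuel k → n * n ≤ fuel + k → Distinct k → Outcome
    search zero       k n²≤k  distinct = ⊥-elim (<⇒≱ (distinct-bounded distinct) n²≤k)
    search (suc fuel) k bound distinct with E (suc k) ≟ₑ E k
    ... | yes halted = halts k distinct halted
    ... | no moved with distinct-step distinct moved
    ...   | inj₂ closed    = closes k distinct moved closed
    ...   | inj₁ distinct′ = search fuel (suc k) (subst (n * n ≤_) (sym (+-suc fuel k)) bound) distinct′

  run : Outcome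
  run = search (n * n) 0 (≤-reflexive (sym (+-identityʳ _))) (λ { i zero () _ })

  fixed-start-never-closes : s (V 0) (E 0) ≡ E 0 → ∀ {k} → Distinct k → E (suc k) ≢ E k → ¬ Closes k
  fixed-start-never-closes fixed {zero}  _        moved (E≡E₀ , _)     = moved E≡E₀
  fixed-start-never-closes fixed {suc k} distinct _     (E≡E₀ , V≡V₀) =
    distinct 0 (suc k) (s≤s z≤n) ≤-refl (sym last≡first)
    where
      last≡first : E (suc k) ≡ E 0
      last≡first = trans (sym (s-back (suc k))) (trans (cong₂ s V≡V₀ E≡E₀) fixed)

  path : ∀ {k} → Distinct k → ∀ i → i ≤ k → Star (LAdj ∇ s) (E 0) (E i)
  path distinct zero    _    = ε
  path distinct (suc i) i<k  = path distinct i (<⇒≤ i<k) ◅◅ (adjacent ◅ ε)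
    where
      adjacent : LAdj ∇ s (E i) (E (suc i))
      adjacent = ∇E i , ∇E (suc i) , distinct i (suc i) (n<1+n i) i<k
               , inj₁ (V (suc i) , joins-∈₂ (E i) (joins i) , joins-∈₁ (E (suc i)) (joins (suc i)) , refl)

  ClosedEnds OpenEnds : ℕ → Set
  ClosedEnds k = V (suc k) ≡ V 0 × s (V 0) (E k) ≡ E 0
  OpenEnds   k = s (V 0) (E 0) ≡ E 0 × s (V (suc k)) (E k) ≡ E k

  Visited : ℕ → EdgeSet n
  Visited k f = ∃ λ j → j ≤ k × E j ≡ f

  Ends : ℕ → Set
  Ends k = ClosedEnds k ⊎ OpenEnds k

  s-entry-visited : ∀ {k} → Ends k → ∀ j → j ≤ k → Visited k (s (V j) (E j))
  s-entry-visited _ (suc j) 1+j≤k = j , <⇒≤ 1+j≤k , sym (s-back j)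
  s-entry-visited {k} (inj₁ (V≡V₀ , closing)) zero _ = k , ≤-refl ,
    sym (pairing-flip pairing (subst (_∈ₑ E k) V≡V₀ (joins-∈₂ (E k) (joins k))) (∇E k) closing)
  s-entry-visited (inj₂ (fixed₀ , _)) zero _ = 0 , z≤n , sym fixed₀

  s-exit-visited : ∀ {k} → Ends k → ∀ j → j ≤ k → Visited k (s (V (suc j)) (E j))
  s-exit-visited ends j j≤k with m≤n⇒m<n∨m≡n j≤k | ends
  ... | inj₁ j<k  | _                       = suc j , j<k , refl
  ... | inj₂ refl | inj₁ (V≡V₀ , closing) =
    0 , z≤n , sym (trans (cong (λ x → s x (E j)) V≡V₀) closing)
  ... | inj₂ refl | inj₂ (_ , fixedₖ)     = j , ≤-refl , sym fixedₖ

  Visited-s-closed : ∀ {k} → Ends k → ∀ {v f} → v ∈ₑ f → Visited k f → Visited k (s v f)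
  Visited-s-closed ends v∈ (j , j≤k , refl) with joins-cases (E j) (joins j) v∈
  ... | inj₁ refl = s-entry-visited ends j j≤k
  ... | inj₂ refl = s-exit-visited ends j j≤k

  trail : ℕ → TrailData n
  trail k = record { m = k ; es = E ∘ toℕ ; vs = V ∘ toℕ }

  trail-isTrailOf : ∀ {e₀} k → Distinct k → Star (LAdj ∇ s) e₀ (E 0) → Ends k
                  → IsTrailOf (Comp ∇ s e₀) s (trail k)
  trail-isTrailOf {e₀} k distinct e₀~E₀ ends = injective , inW , covers , joins′ , ordered
    where
      injective : ∀ {i j : Fin (suc k)} → E (toℕ i) ≡ E (toℕ j) → i ≡ j
      injective {i} {j} eq with <-cmp (toℕ i) (toℕ j)
      ... | tri< i<j _ _ = ⊥-elim (distinct _ _ i<j (≤-pred (Finₚ.toℕ<n j)) eq)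
      ... | tri≈ _ i≡j _ = Finₚ.toℕ-injective i≡j
      ... | tri> _ _ j<i = ⊥-elim (distinct _ _ j<i (≤-pred (Finₚ.toℕ<n i)) (sym eq))

      inW : ∀ (i : Fin (suc k)) → Comp ∇ s e₀ (E (toℕ i))
      inW i = e₀~E₀ ◅◅ path distinct (toℕ i) (≤-pred (Finₚ.toℕ<n i))

      covers : ∀ f → Comp ∇ s e₀ f → ∃ λ (i : Fin (suc k)) → E (toℕ i) ≡ f
      covers f e₀~f
        with s-closed⇒Star-closed pairing (Visited k) (Visited-s-closed ends)
               (reverse LAdj-sym e₀~E₀ ◅◅ e₀~f) (0 , z≤n , refl)
      ... | j , j≤k , Ej≡f = fromℕ< (s≤s j≤k) , trans (cong E (Finₚ.toℕ-fromℕ< (s≤s j≤k))) Ej≡f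

      joins′ : ∀ (i : Fin (suc k)) → Joins (E (toℕ i)) (V (toℕ (Fin.inject₁ i))) (V (suc (toℕ i)))
      joins′ i = subst (λ j → Joins (E (toℕ i)) (V j) (V (suc (toℕ i))))
                       (sym (Finₚ.toℕ-inject₁ i)) (joins (toℕ i))

      ordered : ∀ (i : Fin k)
              → s (V (suc (toℕ (Fin.inject₁ i)))) (E (toℕ (Fin.inject₁ i))) ≡ E (suc (toℕ i))
      ordered i = cong (E ∘ suc) (Finₚ.toℕ-inject₁ i)

  trail-ends : ∀ k → Ends k → ClosedTrail s (trail k) ⊎ OpenTrail s (trail k)
  trail-ends k ends rewrite Finₚ.toℕ-fromℕ k = ends

  closed-trail : ∀ {e₀} k → Distinct k → Closes k → Star (LAdj ∇ s) e₀ (E 0)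
               → DescribesEulerianTrail (Comp ∇ s e₀) s
  closed-trail k distinct (E≡E₀ , V≡V₀) e₀~E₀ =
    trail k , trail-isTrailOf k distinct e₀~E₀ ends , trail-ends k ends
    where
      ends : Ends k
      ends = inj₁ (V≡V₀ , trans (cong (λ x → s x (E k)) (sym V≡V₀)) E≡E₀)

  open-trail : ∀ {e₀} → s (V 0) (E 0) ≡ E 0 → Star (LAdj ∇ s) e₀ (E 0)
             → DescribesEulerianTrail (Comp ∇ s e₀) s
  open-trail fixed e₀~E₀ with run
  ... | halts k distinct halted = trail k , trail-isTrailOf k distinct e₀~E₀ ends , trail-ends k ends
    where
      ends : Ends k
      ends = inj₂ (fixed , halted)
  ... | closes k distinct moved closed = ⊥-elim (fixed-start-never-closes fixed distinct moved closed)

Comp-describesEulerianTrail : ∀ {∇ : EdgeSet n} {s} → IsPairing ∇ s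
                            → ∀ {e₀} → ∇ e₀ → DescribesEulerianTrail (Comp ∇ s e₀) s
Comp-describesEulerianTrail {∇ = ∇} {s} pairing {e₀} ∇e₀ = describe W.run
  where
    module W = Walk {∇ = ∇} {s} pairing e₀ (proj₁ (proj₁ e₀)) ∇e₀ (inj₁ refl)

    describe : W.Outcome → DescribesEulerianTrail (Comp ∇ s e₀) s
    describe (W.closes k distinct _ closed) = W.closed-trail k distinct closed ε
    describe (W.halts k distinct halted)    =
      Back.open-trail halted (W.path distinct k ≤-refl)
      where
        module Back = Walk {∇ = ∇} {s} pairing (W.E k) (W.V (suc k)) (W.∇E k) (joins-∈₂ (W.E k) (W.joins k))

module _ {W : EdgeSet n} {s : PairFun n} {D : TrailData n} where

  openTrail-start-fixed : IsTrailOf W s D → OpenTrail s D → FixedAt W s (startV D) (es D Fin.zero)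
  openTrail-start-fixed (_ , inW , _ , joins , _) (fixed₀ , _) =
    joins-∈₁ (es D Fin.zero) (joins Fin.zero) , inW Fin.zero , fixed₀

  openTrail-end-fixed : IsTrailOf W s D → OpenTrail s D → FixedAt W s (endV D) (es D (fromℕ (m D)))
  openTrail-end-fixed (_ , inW , _ , joins , _) (_ , fixedₘ) =
    joins-∈₂ (es D (fromℕ (m D))) (joins (fromℕ (m D))) , inW (fromℕ (m D)) , fixedₘ

  -- Equal ends would make the two fixed end edges equal, so the trail would be a single
  -- edge joining startV D to itself.
  openTrail-ends-distinct : AtMostOneFixed W s → IsTrailOf W s D → OpenTrail s D → startV D ≢ endV D
  openTrail-ends-distinct atMostOne trail@(injective , _ , _ , joins , _) open′ start≡end =
    joins-≢ (es D Fin.zero) (joins Fin.zero)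
      (trans start≡end (cong (vs D ∘ Fin.suc) (injective last≡first)))
    where
      last≡first : es D (fromℕ (m D)) ≡ es D Fin.zero
      last≡first = atMostOne
        (subst (λ x → FixedAt W s x (es D (fromℕ (m D)))) (sym start≡end) (openTrail-end-fixed trail open′))
        (openTrail-start-fixed trail open′)

module _ {∇ : EdgeSet n} {s : PairFun n} (atMostOne : AtMostOneFixed ∇ s)
         {e₀ e₁} (∇e₀ : ∇ e₀) (∇e₁ : ∇ e₁) (e₀≁e₁ : ¬ Comp ∇ s e₀ e₁) where

  fixed-vertices-apart : ∀ {x y g h}
                       → FixedAt (Comp ∇ s e₀) s x g → FixedAt (Comp ∇ s e₁) s y h → x ≢ y
  fixed-vertices-apart {g = g} {h} (x∈g , e₀~g , sg≡g) (x∈h , e₁~h , sh≡h) refl =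
    e₀≁e₁ (subst (Comp ∇ s e₀) g≡h e₀~g ◅◅ reverse LAdj-sym e₁~h)
    where
      g≡h : g ≡ h
      g≡h = atMostOne (x∈g , Comp-⊆ ∇e₀ e₀~g , sg≡g) (x∈h , Comp-⊆ ∇e₁ e₁~h , sh≡h)

  openTrails-disjointEnds : ∀ {D D′} → IsTrailOf (Comp ∇ s e₀) s D → OpenTrail s D
                          → IsTrailOf (Comp ∇ s e₁) s D′ → OpenTrail s D′
                          → DisjointEnds (startV D) (endV D) (startV D′) (endV D′)
  openTrails-disjointEnds {D} {D′} trail open′ trail′ open″ =
      fixed-vertices-apart start start′ , fixed-vertices-apart start end′
    , fixed-vertices-apart end start′   , fixed-vertices-apart end end′
    where
      start = openTrail-start-fixed {W = Comp ∇ s e₀} {s} {D} trail open′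
      end   = openTrail-end-fixed {W = Comp ∇ s e₀} {s} {D} trail open′
      start′ = openTrail-start-fixed {W = Comp ∇ s e₁} {s} {D′} trail′ open″
      end′   = openTrail-end-fixed {W = Comp ∇ s e₁} {s} {D′} trail′ open″

lemma3p21 : ∀ {n} (ℓ u : Fin n → ℕ) → IsDegSeq ℓ → IsDegSeq u
    → (∀ i → ℓ i ≤ u i) → Thin ℓ u
    → (X Y : Graph n) → InG ℓ u X → InG ℓ u Y
    → (s : PairFun n) → InS X Y s
    → (e₀ : Edge n) → Δ X Y e₀
    → (RestrictionIsPairing (Comp (Δ X Y) s e₀) s
         × Alternating X (Comp (Δ X Y) s e₀) s
         × Alternating Y (Comp (Δ X Y) s e₀) s)
      × DescribesEulerianTrail (Comp (Δ X Y) s e₀) s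
      × (∀ D → IsTrailOf (Comp (Δ X Y) s e₀) s D → OpenTrail s D
           → (startV D ≢ endV D)
             × (∀ e₁ → Δ X Y e₁ → ¬ Comp (Δ X Y) s e₀ e₁
                  → ∀ D′ → IsTrailOf (Comp (Δ X Y) s e₁) s D′ → OpenTrail s D′
                  → DisjointEnds (startV D) (endV D) (startV D′) (endV D′)))
lemma3p21 _ _ _ _ _ _ X Y _ _ s (pairing , altX , altY) e₀ ∇e₀ =
    (Comp-isPairing pairing ∇e₀ , altX-Comp , Alternating-⊆ (Comp-⊆ ∇e₀) altY)
  , Comp-describesEulerianTrail pairing ∇e₀
  , λ D trail open′ →
        openTrail-ends-distinct {D = D} (Alternating⇒atMostOneFixed altX-Comp) trail open′
      , λ e₁ ∇e₁ e₀≁e₁ D′ trail′ open″ →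
          openTrails-disjointEnds (Alternating⇒atMostOneFixed altX) ∇e₀ ∇e₁ e₀≁e₁ {D} {D′}
            trail open′ trail′ open″
  where
    altX-Comp : Alternating X (Comp (Δ X Y) s e₀) s
    altX-Comp = Alternating-⊆ (Comp-⊆ ∇e₀) altX
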